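{- Let $X$ be a finite set with $|X|\geq 5$, let $M$ be a set, let $x_1\neq x_2\in X$, and let $\delta:\binom{X}{3}\to\mathcal M$ be a three-way symbolic map. Then $\delta$ can be represented by a fixed-cherry tree on $X$ with cherry $\{x_1,x_2\}$ if and only if $\delta$ is a fixed-cherry map with cherry $\{x_1,x_2\}$.
   Context: $\mathcal M$ is the set of multisets of size three over $M$, written as sums (e.g. $2a+b=\{a,a,b\}$). A labelled rooted tree on $X$ is a pair $(T,t)$ with $T$ a rooted tree with leaf set $X$ having no vertex of indegree one and outdegree one, and $t$ a map from internal vertices to $M$; $\mathrm{lca}_T(x,y)$ is the last common vertex of the root-to-$x$ and root-to-$y$ paths; $(T,t)$ represents $\delta$ if $\delta(x,y,z)=\{t(\mathrm{lca}_T(x,y)),t(\mathrm{lca}_T(x,z)),t(\mathrm{lca}_T(y,z))\}$ for all distinct $x,y,z$. A fixed-cherry tree on $X$ with cherry $\{x_1,x_2\}$ is a labelled rooted tree $(T,t)$ on $X$ whose root $\rho_T$ has exactly two children $v,w$ with $t(v)=t(w)\neq t(\rho_T)$, the children of $v$ being exactly $x_1,x_2$ and the children of $w$ being exactly the elements of $X\setminus\{x_1,x_2\}$. A fixed-cherry map with cherry $\{x_1,x_2\}$ is a map $\delta:\binom{X}{3}\to\mathcal M$ for which there exist $a\neq b$ in $M$ such that $\delta(x,y,z)=3b$ whenever $\{x,y,z\}\cap\{x_1,x_2\}=\emptyset$ and $\delta(x,y,z)=2a+b$ otherwise. -}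

module Defs where

open import Data.Nat using (ℕ; _≤_)
open import Data.Fin using (Fin; _<_)
open import Data.List using (List; []; _∷_; _++_; length; map; lookup; allFin)
open import Data.Vec using (Vec; toList) renaming (_∷_ to _∷ᵥ_; [] to []ᵥ)
open import Data.List.Membership.Propositional using (_∈_; _∉_)
open import Data.List.Relation.Binary.Permutation.Propositional using (_↭_)
open import Data.Product using (Σ; ∃; ∃-syntax; _×_; _,_)
open import Data.Sum using (_⊎_)
open import Data.Unit using (⊤)
open import Relation.Binary.PropositionalEquality using (_≡_; _≢_)

-- Multisets of size three over M (the set 𝓜): triples up to permutation.

MS3 : Set → Set
MS3 M = Vec M 3

_≈ₘ_ : {M : Set} → MS3 M → MS3 M → Set
u ≈ₘ v = toList u ↭ toList v

⟅_,_,_⟆ : {M : Set} → M → M → M → MS3 M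
⟅ a , b , c ⟆ = a ∷ᵥ b ∷ᵥ c ∷ᵥ []ᵥ

-- The finite set X is Fin n.  A three-way symbolic map δ : (X choose 3) → 𝓜
-- is given on 3-subsets {x,y,z}, each listed once in increasing order.

ThreeWayMap : ℕ → Set → Set
ThreeWayMap n M = (x y z : Fin n) → x < y → y < z → MS3 M

data RTree (X M : Set) : Set where
  leaf : X → RTree X M
  node : M → List (RTree X M) → RTree X M

module _ {X M : Set} where

  mutual
    leaves : RTree X M → List X
    leaves (leaf x)    = x ∷ []
    leaves (node _ ts) = leavesL ts

    leavesL : List (RTree X M) → List X
    leavesL []       = []
    leavesL (t ∷ ts) = leaves t ++ leavesL ts

  -- non-root vertices: no vertex with indegree one and outdegree one, and
  -- every internal vertex has a child (outdegree-0 vertices are the leaves)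
  mutual
    InnerOK : RTree X M → Set
    InnerOK (leaf _)    = ⊤
    InnerOK (node _ ts) = (2 ≤ length ts) × InnerOKL ts

    InnerOKL : List (RTree X M) → Set
    InnerOKL []       = ⊤
    InnerOKL (t ∷ ts) = InnerOK t × InnerOKL ts

  -- root (indegree zero): it only needs at least one child if internal
  RootOK : RTree X M → Set
  RootOK (leaf _)    = ⊤
  RootOK (node _ ts) = (1 ≤ length ts) × InnerOKL ts

  -- LcaLabel T x y m : m = t(lca_T(x,y))
  data LcaLabel : RTree X M → X → X → M → Set where
    here  : ∀ {m ts x y} (i j : Fin (length ts)) → i ≢ j →
            x ∈ leaves (lookup ts i) → y ∈ leaves (lookup ts j) →
            LcaLabel (node m ts) x y m
    there : ∀ {m m' ts x y} (i : Fin (length ts)) →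
            LcaLabel (lookup ts i) x y m' → LcaLabel (node m ts) x y m'

IsTreeOn : (n : ℕ) {M : Set} → RTree (Fin n) M → Set
IsTreeOn n T = (leaves T ↭ allFin n) × RootOK T

Represents : {n : ℕ} {M : Set} → RTree (Fin n) M → ThreeWayMap n M → Set
Represents {n} {M} T δ =
  (x y z : Fin n) (p : x < y) (q : y < z) →
  ∃[ a ] ∃[ b ] ∃[ c ]
    (LcaLabel T x y a × LcaLabel T x z b × LcaLabel T y z c ×
     (δ x y z p q ≈ₘ ⟅ a , b , c ⟆))

FixedCherryTree : (n : ℕ) {M : Set} → Fin n → Fin n → RTree (Fin n) M → Set
FixedCherryTree n {M} x₁ x₂ T =
  IsTreeOn n T ×
  ∃[ r ] ∃[ cs ] (T ≡ node r cs ×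
    ∃[ a ] (a ≢ r × ∃[ vs ] ∃[ ws ]
      ((cs ↭ (node a vs ∷ node a ws ∷ [])) ×
      ∃[ xs ] (vs ≡ map leaf xs × xs ↭ (x₁ ∷ x₂ ∷ [])) ×
      ∃[ ys ] (ws ≡ map leaf ys × (x₁ ∷ x₂ ∷ ys) ↭ allFin n))))

FixedCherryMap : {n : ℕ} {M : Set} → Fin n → Fin n → ThreeWayMap n M → Set
FixedCherryMap {n} {M} x₁ x₂ δ =
  ∃[ a ] ∃[ b ] (a ≢ b ×
    ((x y z : Fin n) (p : x < y) (q : y < z) →
      (x ∉ C → y ∉ C → z ∉ C → δ x y z p q ≈ₘ ⟅ b , b , b ⟆) ×
      (x ∈ C ⊎ y ∈ C ⊎ z ∈ C → δ x y z p q ≈ₘ ⟅ a , a , b ⟆)))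
  where
    C : List (Fin n)
    C = x₁ ∷ x₂ ∷ []

-- In a fixed-cherry tree every leaf lies in one of the two children of the root,
-- so t(lca(x,y)) is the label a of those children when x and y lie on the same
-- side of the cherry and the root label r otherwise.  A triple meets the cherry
-- in at most two leaves; if it misses it, all three pairs are on one side
-- (3a), and otherwise exactly two pairs straddle it (2r + a).  Conversely, given
-- the constants a ≠ b of a fixed-cherry map, the tree with root label a and
-- child label b represents it; |X| ≥ 5 makes the second child a legal vertex.
module Submission where

open import Defs
open import Data.Bool using (Bool; true; false; not; _∧_; _∨_; T)
open import Data.Bool.Properties using (T-∧; T-∨)
open import Data.Empty using (⊥; ⊥-elim)
open import Data.Fin using (Fin; _<_; zero; suc)
open import Data.Fin.Properties using (<-trans; <⇒≢) renaming (_≟_ to _≟ᶠ_)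
open import Data.List using (List; []; _∷_; _++_; length; map; lookup; allFin)
open import Data.List.Properties using (++-identityʳ; length-map; length-tabulate)
open import Data.List.Membership.Propositional using (_∈_; _∉_)
open import Data.List.Membership.Propositional.Properties using (∈-allFin; ∈-map⁺; ∈-∃++; ∈-++⁺ˡ; ∈-++⁺ʳ)
open import Data.List.Relation.Unary.All using (All; _∷_)
open import Data.List.Relation.Unary.AllPairs using (_∷_)
open import Data.List.Relation.Unary.Any using (here; there; index)
open import Data.List.Relation.Unary.Any.Properties using (lookup-index)
open import Data.List.Relation.Unary.Unique.Propositional using (Unique)
open import Data.List.Relation.Unary.Unique.Propositional.Properties using (allFin⁺)
open import Data.List.Relation.Binary.Permutation.Propositional
  using (_↭_; refl; prep; swap; ↭-refl; ↭-sym; ↭-trans; ↭⇒↭ₛ)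
open import Data.List.Relation.Binary.Permutation.Propositional.Properties
  using (↭-empty-inv; ↭-singleton-inv; ∈-resp-↭; ↭-length; shift)
import Data.List.Relation.Binary.Permutation.Setoid.Properties as PermutationSetoid
open import Data.Nat using (ℕ; _≤_; _+_; z≤n; s≤s)
open import Data.Nat.Properties using (+-cancelˡ-≤; ≤-trans; n≤1+n)
open import Data.Product using (∃-syntax; _×_; _,_)
open import Data.Sum using (_⊎_; inj₁; inj₂)
import Data.Sum as Sum
open import Data.Unit using (tt)
open import Function using (_∘_)
open import Function.Bundles using (_⇔_; mk⇔; Equivalence)
open import Relation.Nullary using (¬_; yes; no; does)
open import Relation.Nullary.Decidable using (_⊎-dec_; dec-true; dec-false)
open import Relation.Binary.PropositionalEquality
  using (_≡_; _≢_; refl; sym; trans; cong; subst; setoid)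

open Equivalence using (to; from)

module _ {A : Set} where

  ↭-pair-inv : ∀ {xs : List A} {a b : A} → xs ↭ a ∷ b ∷ [] →
               xs ≡ a ∷ b ∷ [] ⊎ xs ≡ b ∷ a ∷ []
  ↭-pair-inv refl = inj₁ refl
  ↭-pair-inv (prep _ p) with refl ← ↭-singleton-inv p = inj₁ refl
  ↭-pair-inv (swap _ _ p) with refl ← ↭-empty-inv p = inj₂ refl
  ↭-pair-inv (_↭_.trans p q) with ↭-pair-inv q
  ... | inj₁ refl = ↭-pair-inv p
  ... | inj₂ refl = Sum.swap (↭-pair-inv p)

  ∈-∃↭ : ∀ {x : A} {xs} → x ∈ xs → ∃[ ys ] (xs ↭ x ∷ ys)
  ∈-∃↭ {x} x∈xs with ys , zs , refl ← ∈-∃++ x∈xs = ys ++ zs , shift x ys zs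

  Unique-resp-↭ : ∀ {xs ys : List A} → xs ↭ ys → Unique xs → Unique ys
  Unique-resp-↭ p = PermutationSetoid.Unique-resp-↭ (setoid A) (↭⇒↭ₛ p)

  All≢⇒∉ : ∀ {x : A} {xs} → All (x ≢_) xs → x ∉ xs
  All≢⇒∉ (x≢y ∷ _) (here x≡y) = x≢y x≡y
  All≢⇒∉ (_ ∷ x≢ys) (there x∈xs) = All≢⇒∉ x≢ys x∈xs

  pigeonhole-pair : ∀ {u v x y z : A} → x ∈ u ∷ v ∷ [] → y ∈ u ∷ v ∷ [] → z ∈ u ∷ v ∷ [] →
                    x ≢ y → x ≢ z → y ≢ z → ⊥
  pigeonhole-pair (here refl) (here refl) _ x≢y _ _ = x≢y refl
  pigeonhole-pair (there (here refl)) (there (here refl)) _ x≢y _ _ = x≢y refl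
  pigeonhole-pair (here refl) (there (here refl)) (here refl) _ x≢z _ = x≢z refl
  pigeonhole-pair (there (here refl)) (here refl) (there (here refl)) _ x≢z _ = x≢z refl
  pigeonhole-pair (here refl) (there (here refl)) (there (here refl)) _ _ y≢z = y≢z refl
  pigeonhole-pair (there (here refl)) (here refl) (here refl) _ _ y≢z = y≢z refl
  pigeonhole-pair (there (there ())) _ _
  pigeonhole-pair _ (there (there ())) _
  pigeonhole-pair _ _ (there (there ()))

module _ {M : Set} (r a : M) where

  sideLabel : Bool → Bool → M
  sideLabel true  true  = a
  sideLabel false false = a
  sideLabel true  false = r
  sideLabel false true  = r

  sideLabel-not : ∀ s t → sideLabel (not s) (not t) ≡ sideLabel s t
  sideLabel-not true  true  = refl
  sideLabel-not true  false = refl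
  sideLabel-not false true  = refl
  sideLabel-not false false = refl

  sideLabel-triple : ∀ s t u → T (s ∨ t ∨ u) → ¬ T (s ∧ t ∧ u) →
                     ⟅ sideLabel s t , sideLabel s u , sideLabel t u ⟆ ≈ₘ ⟅ r , r , a ⟆
  sideLabel-triple true  true  true  _ ¬all = ⊥-elim (¬all tt)
  sideLabel-triple true  true  false _ _    = ↭-trans (swap a r refl) (prep r (swap a r refl))
  sideLabel-triple true  false true  _ _    = prep r (swap a r refl)
  sideLabel-triple true  false false _ _    = ↭-refl
  sideLabel-triple false true  true  _ _    = ↭-refl
  sideLabel-triple false true  false _ _    = prep r (swap a r refl)
  sideLabel-triple false false true  _ _    = ↭-trans (swap a r refl) (prep r (swap a r refl))

module _ {X M : Set} where

  star : M → List X → RTree X M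
  star c xs = node c (map leaf xs)

  leavesL-map-leaf : (xs : List X) → leavesL {X} {M} (map leaf xs) ≡ xs
  leavesL-map-leaf []       = refl
  leavesL-map-leaf (x ∷ xs) = cong (x ∷_) (leavesL-map-leaf xs)

  InnerOKL-map-leaf : (xs : List X) → InnerOKL {X} {M} (map leaf xs)
  InnerOKL-map-leaf []       = tt
  InnerOKL-map-leaf (x ∷ xs) = tt , InnerOKL-map-leaf xs

  ∈-leaves-lookup : ∀ {x} (ts : List (RTree X M)) (i : Fin (length ts)) →
                    x ∈ leaves (lookup ts i) → x ∈ leavesL ts
  ∈-leaves-lookup (t ∷ ts) zero    x∈t = ∈-++⁺ˡ x∈t
  ∈-leaves-lookup (t ∷ ts) (suc i) x∈t =
    ∈-++⁺ʳ (leaves t) (∈-leaves-lookup ts i x∈t)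

  LcaLabel⇒∈leaves : ∀ {t x y m} → LcaLabel t x y m → x ∈ leaves t × y ∈ leaves t
  LcaLabel⇒∈leaves (here {ts = ts} i j _ x∈ y∈) = ∈-leaves-lookup ts i x∈ , ∈-leaves-lookup ts j y∈
  LcaLabel⇒∈leaves (there {ts = ts} i p) =
    let x∈ , y∈ = LcaLabel⇒∈leaves p in ∈-leaves-lookup ts i x∈ , ∈-leaves-lookup ts i y∈

  ∈-leavesL-map-leaf⁻ : ∀ {x} {xs : List X} → x ∈ leavesL {M = M} (map leaf xs) → x ∈ xs
  ∈-leavesL-map-leaf⁻ {xs = xs} = subst (_ ∈_) (leavesL-map-leaf xs)

  ∈-leavesL-map-leaf⁺ : ∀ {x} {xs : List X} → x ∈ xs → x ∈ leavesL {M = M} (map leaf xs)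
  ∈-leavesL-map-leaf⁺ {xs = xs} = subst (_ ∈_) (sym (leavesL-map-leaf xs))

  ¬LcaLabel-lookup-map-leaf : ∀ {x y m} (xs : List X) (i : Fin (length (map leaf xs))) →
                              ¬ LcaLabel {M = M} (lookup (map leaf xs) i) x y m
  ¬LcaLabel-lookup-map-leaf (_ ∷ _)  zero    ()
  ¬LcaLabel-lookup-map-leaf (_ ∷ xs) (suc i) p = ¬LcaLabel-lookup-map-leaf xs i p

  LcaLabel-star⁻ : ∀ {c x y m} {xs : List X} → LcaLabel (star c xs) x y m → m ≡ c × x ∈ xs × y ∈ xs
  LcaLabel-star⁻ {xs = xs} (there i p) = ⊥-elim (¬LcaLabel-lookup-map-leaf xs i p)
  LcaLabel-star⁻ p@(here _ _ _ _ _) =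
    let x∈ , y∈ = LcaLabel⇒∈leaves p in refl , ∈-leavesL-map-leaf⁻ x∈ , ∈-leavesL-map-leaf⁻ y∈

  LcaLabel-star⁺ : ∀ {c x y} {xs : List X} → x ∈ xs → y ∈ xs → x ≢ y → LcaLabel (star c xs) x y c
  LcaLabel-star⁺ {x = x} {y} {xs} x∈xs y∈xs x≢y =
    here (index x∈) (index y∈) index≢
      (subst (λ t → x ∈ leaves t) (lookup-index x∈) (here refl))
      (subst (λ t → y ∈ leaves t) (lookup-index y∈) (here refl))
    where
    x∈ = ∈-map⁺ (leaf {M = M}) x∈xs
    y∈ = ∈-map⁺ (leaf {M = M}) y∈xs
    leaf-injective : ∀ {u v : X} → leaf {M = M} u ≡ leaf v → u ≡ v
    leaf-injective refl = refl
    index≢ : index x∈ ≢ index y∈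
    index≢ i≡j = x≢y (leaf-injective (trans (lookup-index x∈)
                   (trans (cong (lookup (map leaf xs)) i≡j) (sym (lookup-index y∈)))))

  twoStars : M → M → List X → List X → RTree X M
  twoStars r a us vs = node r (star a us ∷ star a vs ∷ [])

  module _ {r a : M} {us vs : List X} (σ : X → Bool)
           (us-true : ∀ {x} → x ∈ us → σ x ≡ true)
           (vs-false : ∀ {x} → x ∈ vs → σ x ≡ false) where

    LcaLabel-twoStars⁻ : ∀ {x y m} → LcaLabel (twoStars r a us vs) x y m → m ≡ sideLabel r a (σ x) (σ y)
    LcaLabel-twoStars⁻ (here zero zero 0≢0 _ _) = ⊥-elim (0≢0 refl)
    LcaLabel-twoStars⁻ (here (suc zero) (suc zero) 1≢1 _ _) = ⊥-elim (1≢1 refl)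
    LcaLabel-twoStars⁻ (here zero (suc zero) _ x∈ y∈)
      rewrite us-true (∈-leavesL-map-leaf⁻ x∈) | vs-false (∈-leavesL-map-leaf⁻ y∈) = refl
    LcaLabel-twoStars⁻ (here (suc zero) zero _ x∈ y∈)
      rewrite vs-false (∈-leavesL-map-leaf⁻ x∈) | us-true (∈-leavesL-map-leaf⁻ y∈) = refl
    LcaLabel-twoStars⁻ (there zero p) with refl , x∈ , y∈ ← LcaLabel-star⁻ p
      rewrite us-true x∈ | us-true y∈ = refl
    LcaLabel-twoStars⁻ (there (suc zero) p) with refl , x∈ , y∈ ← LcaLabel-star⁻ p
      rewrite vs-false x∈ | vs-false y∈ = refl

    LcaLabel-twoStars⁺ : ∀ {x y} → x ∈ us ⊎ x ∈ vs → y ∈ us ⊎ y ∈ vs → x ≢ y →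
                         LcaLabel (twoStars r a us vs) x y (sideLabel r a (σ x) (σ y))
    LcaLabel-twoStars⁺ (inj₁ x∈) (inj₁ y∈) x≢y
      rewrite us-true x∈ | us-true y∈ = there zero (LcaLabel-star⁺ x∈ y∈ x≢y)
    LcaLabel-twoStars⁺ (inj₂ x∈) (inj₂ y∈) x≢y
      rewrite vs-false x∈ | vs-false y∈ = there (suc zero) (LcaLabel-star⁺ x∈ y∈ x≢y)
    LcaLabel-twoStars⁺ {y = y} (inj₁ x∈) (inj₂ y∈) _
      rewrite us-true x∈ | vs-false y∈ =
        here zero (suc zero) (λ ()) (∈-leavesL-map-leaf⁺ x∈)
                                     (∈-leavesL-map-leaf⁺ y∈)
    LcaLabel-twoStars⁺ (inj₂ x∈) (inj₁ y∈) _
      rewrite vs-false x∈ | us-true y∈ =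
        here (suc zero) zero (λ ()) (∈-leavesL-map-leaf⁺ x∈)
                                     (∈-leavesL-map-leaf⁺ y∈)

module _ {n : ℕ} {M : Set} where

  InducedBy : ThreeWayMap n M → (Fin n → Fin n → M) → Set
  InducedBy δ ℓ = (x y z : Fin n) (p : x < y) (q : y < z) →
                  δ x y z p q ≈ₘ ⟅ ℓ x y , ℓ x z , ℓ y z ⟆

  Represents⇒InducedBy : ∀ {T δ} {ℓ : Fin n → Fin n → M} →
                         (∀ {x y m} → LcaLabel T x y m → m ≡ ℓ x y) →
                         Represents T δ → InducedBy δ ℓ
  Represents⇒InducedBy lca rep x y z p q
    with _ , _ , _ , lxy , lxz , lyz , δ≈ ← rep x y z p q
    rewrite lca lxy | lca lxz | lca lyz = δ≈

  InducedBy⇒Represents : ∀ {T δ} {ℓ : Fin n → Fin n → M} →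
                         (∀ {x y} → x ≢ y → LcaLabel T x y (ℓ x y)) →
                         InducedBy δ ℓ → Represents T δ
  InducedBy⇒Represents lca induced x y z p q =
    _ , _ , _ , lca (<⇒≢ p) , lca (<⇒≢ (<-trans p q)) , lca (<⇒≢ q) , induced x y z p q

module Cherry {n : ℕ} (x₁ x₂ : Fin n) where

  open import Data.List.Membership.DecPropositional (_≟ᶠ_ {n}) using (_∈?_)

  cherry : List (Fin n)
  cherry = x₁ ∷ x₂ ∷ []

  inCherry : Fin n → Bool
  inCherry x = does (x ∈? cherry)

  cherryLabel : {M : Set} → M → M → Fin n → Fin n → M
  cherryLabel r a x y = sideLabel r a (inCherry x) (inCherry y)

  Complement : List (Fin n) → Set
  Complement ys = x₁ ∷ x₂ ∷ ys ↭ allFin n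

  complement : x₁ ≢ x₂ → ∃[ ys ] Complement ys
  complement x₁≢x₂ with xs , all↭x₁xs ← ∈-∃↭ (∈-allFin x₁)
                   with ∈-resp-↭ all↭x₁xs (∈-allFin x₂)
  ... | here x₂≡x₁ = ⊥-elim (x₁≢x₂ (sym x₂≡x₁))
  ... | there x₂∈xs with ys , xs↭x₂ys ← ∈-∃↭ x₂∈xs =
    ys , ↭-sym (↭-trans all↭x₁xs (prep x₁ xs↭x₂ys))

  ∈-complement⇒∉ : ∀ {ys x} → Complement ys → x ∈ ys → x ∉ cherry
  ∈-complement⇒∉ ys-compl x∈ys x∈cherry
    with (_ ∷ x₁∉ys) ∷ x₂∉ys ∷ _ ← Unique-resp-↭ (↭-sym ys-compl) (allFin⁺ n)
    with x∈cherry
  ... | here refl         = All≢⇒∉ x₁∉ys x∈ys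
  ... | there (here refl) = All≢⇒∉ x₂∉ys x∈ys

  ∈-cherry-or-complement : ∀ {ys} → Complement ys → ∀ x → x ∈ cherry ⊎ x ∈ ys
  ∈-cherry-or-complement ys-compl x with ∈-resp-↭ (↭-sym ys-compl) (∈-allFin x)
  ... | here x≡x₁         = inj₁ (here x≡x₁)
  ... | there (here x≡x₂) = inj₁ (there (here x≡x₂))
  ... | there (there x∈ys) = inj₂ x∈ys

  inCherry-∈≡ : ∀ {x} → x ∈ cherry → inCherry x ≡ true
  inCherry-∈≡ {x} = dec-true (x ∈? cherry)

  inCherry-∈ : ∀ {x} → x ∈ cherry → T (inCherry x)
  inCherry-∈ x∈ = subst T (sym (inCherry-∈≡ x∈)) tt

  inCherry-∉ : ∀ {x} → x ∉ cherry → inCherry x ≡ false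
  inCherry-∉ {x} = dec-false (x ∈? cherry)

  inCherry⇒∈ : ∀ {x} → T (inCherry x) → x ∈ cherry
  inCherry⇒∈ {x} t with x ∈? cherry
  ... | yes x∈ = x∈
  ... | no x∉  = ⊥-elim (subst T (inCherry-∉ x∉) t)

  ¬all-inCherry : ∀ {x y z} → x < y → y < z → ¬ T (inCherry x ∧ inCherry y ∧ inCherry z)
  ¬all-inCherry p q all
    with tx , tyz ← to T-∧ all
    with ty , tz ← to T-∧ tyz =
    pigeonhole-pair (inCherry⇒∈ tx) (inCherry⇒∈ ty) (inCherry⇒∈ tz) (<⇒≢ p) (<⇒≢ (<-trans p q)) (<⇒≢ q)

  any-inCherry : ∀ {x y z} → x ∈ cherry ⊎ y ∈ cherry ⊎ z ∈ cherry →
                 T (inCherry x ∨ inCherry y ∨ inCherry z)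
  any-inCherry = from T-∨ ∘ Sum.map inCherry-∈ (from T-∨ ∘ Sum.map inCherry-∈ inCherry-∈)

  module _ {M : Set} (r a : M) {x y z : Fin n} where

    triple : MS3 M
    triple = ⟅ cherryLabel r a x y , cherryLabel r a x z , cherryLabel r a y z ⟆

    triple-outside : x ∉ cherry → y ∉ cherry → z ∉ cherry → triple ≡ ⟅ a , a , a ⟆
    triple-outside x∉ y∉ z∉ rewrite inCherry-∉ x∉ | inCherry-∉ y∉ | inCherry-∉ z∉ = refl

    triple-meets : x < y → y < z → x ∈ cherry ⊎ y ∈ cherry ⊎ z ∈ cherry → triple ≈ₘ ⟅ r , r , a ⟆
    triple-meets p q meets =
      sideLabel-triple r a (inCherry x) (inCherry y) (inCherry z) (any-inCherry meets) (¬all-inCherry p q)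

    -- The clauses of FixedCherryMap at one triple; its constants a, b are r, a here.
    cherry-clauses⇔ : ∀ {D : MS3 M} → x < y → y < z →
      ((x ∉ cherry → y ∉ cherry → z ∉ cherry → D ≈ₘ ⟅ a , a , a ⟆) ×
       (x ∈ cherry ⊎ y ∈ cherry ⊎ z ∈ cherry → D ≈ₘ ⟅ r , r , a ⟆))
      ⇔ D ≈ₘ triple
    cherry-clauses⇔ {D} p q = mk⇔ clauses⇒ clauses⇐
      where
      clauses⇒ : _ → D ≈ₘ triple
      clauses⇒ (outside , meets) with (x ∈? cherry) ⊎-dec (y ∈? cherry) ⊎-dec (z ∈? cherry)
      ... | yes m = ↭-trans (meets m) (↭-sym (triple-meets p q m))
      ... | no ¬m = subst (D ≈ₘ_) (sym (triple-outside x∉ y∉ z∉)) (outside x∉ y∉ z∉)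
        where
        x∉ = ¬m ∘ inj₁
        y∉ = ¬m ∘ inj₂ ∘ inj₁
        z∉ = ¬m ∘ inj₂ ∘ inj₂
      clauses⇐ : D ≈ₘ triple → _
      clauses⇐ D≈ = (λ x∉ y∉ z∉ → subst (D ≈ₘ_) (triple-outside x∉ y∉ z∉) D≈)
                  , (λ m → ↭-trans D≈ (triple-meets p q m))

  FixedCherryMap⇔InducedBy : ∀ {M} {δ : ThreeWayMap n M} →
    FixedCherryMap x₁ x₂ δ ⇔ (∃[ r ] ∃[ a ] (r ≢ a × InducedBy δ (cherryLabel r a)))
  FixedCherryMap⇔InducedBy = mk⇔
    (λ (r , a , r≢a , clauses) →
      r , a , r≢a , λ x y z p q → to (cherry-clauses⇔ r a p q) (clauses x y z p q))
    (λ (r , a , r≢a , induced) →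
      r , a , r≢a , λ x y z p q → from (cherry-clauses⇔ r a p q) (induced x y z p q))

  FixedCherryTree⇒LcaLabel : ∀ {M} {T : RTree (Fin n) M} → FixedCherryTree n x₁ x₂ T →
    ∃[ r ] ∃[ a ] (r ≢ a × (∀ {x y m} → LcaLabel T x y m → m ≡ cherryLabel r a x y))
  FixedCherryTree⇒LcaLabel
    (_ , r , _ , refl , a , a≢r , _ , _ , children , xs , (refl , xs↭cherry) , ys , refl , ys-compl)
    with ↭-pair-inv children
  ... | inj₁ refl = r , a , a≢r ∘ sym , LcaLabel-twoStars⁻ inCherry xs-true ys-false
    where
    xs-true : ∀ {x} → x ∈ xs → inCherry x ≡ true
    xs-true = inCherry-∈≡ ∘ ∈-resp-↭ xs↭cherry
    ys-false : ∀ {x} → x ∈ ys → inCherry x ≡ false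
    ys-false = inCherry-∉ ∘ ∈-complement⇒∉ ys-compl
  ... | inj₂ refl = r , a , a≢r ∘ sym , λ {x} {y} l →
          trans (LcaLabel-twoStars⁻ (not ∘ inCherry) ys-true xs-false l)
                (sideLabel-not r a (inCherry x) (inCherry y))
    where
    ys-true : ∀ {x} → x ∈ ys → not (inCherry x) ≡ true
    ys-true = cong not ∘ inCherry-∉ ∘ ∈-complement⇒∉ ys-compl
    xs-false : ∀ {x} → x ∈ xs → not (inCherry x) ≡ false
    xs-false = cong not ∘ inCherry-∈≡ ∘ ∈-resp-↭ xs↭cherry

  module CherryTree {ys : List (Fin n)} (ys-compl : Complement ys) {M : Set} (r a : M) where

    cherryTree : RTree (Fin n) M
    cherryTree = twoStars r a cherry ys

    2≤length-complement : 5 ≤ n → 2 ≤ length ys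
    2≤length-complement 5≤n =
      +-cancelˡ-≤ 2 2 (length ys) (≤-trans (n≤1+n 4) (subst (5 ≤_) n≡2+length 5≤n))
      where
      n≡2+length : n ≡ 2 + length ys
      n≡2+length = sym (trans (↭-length ys-compl) (length-tabulate _))

    cherryTree-fixedCherry : 5 ≤ n → r ≢ a → FixedCherryTree n x₁ x₂ cherryTree
    cherryTree-fixedCherry 5≤n r≢a =
      (leaves↭ , s≤s z≤n , (s≤s (s≤s z≤n) , tt , tt , tt) , (2≤children , InnerOKL-map-leaf ys) , tt) ,
      r , _ , refl , a , r≢a ∘ sym , _ , _ , ↭-refl ,
      cherry , (refl , ↭-refl) , ys , refl , ys-compl
      where
      leaves↭ : leaves cherryTree ↭ allFin n
      leaves↭ = subst (λ zs → x₁ ∷ x₂ ∷ zs ↭ allFin n)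
                      (sym (trans (++-identityʳ _) (leavesL-map-leaf ys))) ys-compl
      2≤children : 2 ≤ length (map (leaf {M = M}) ys)
      2≤children = subst (2 ≤_) (sym (length-map leaf ys)) (2≤length-complement 5≤n)

    cherryTree-LcaLabel : ∀ {x y} → x ≢ y → LcaLabel cherryTree x y (cherryLabel r a x y)
    cherryTree-LcaLabel {x} {y} =
      LcaLabel-twoStars⁺ inCherry inCherry-∈≡ (inCherry-∉ ∘ ∈-complement⇒∉ ys-compl)
        (∈-cherry-or-complement ys-compl x) (∈-cherry-or-complement ys-compl y)

lemma14 : (n : ℕ) → 5 ≤ n → (M : Set) → (x₁ x₂ : Fin n) → x₁ ≢ x₂ →
          (δ : ThreeWayMap n M) →
          (∃[ T ] (FixedCherryTree n x₁ x₂ T × Represents T δ))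
            ⇔ FixedCherryMap x₁ x₂ δ
lemma14 n 5≤n M x₁ x₂ x₁≢x₂ δ = mk⇔ tree⇒map map⇒tree
  where
  open Cherry x₁ x₂

  tree⇒map : ∃[ T ] (FixedCherryTree n x₁ x₂ T × Represents T δ) → FixedCherryMap x₁ x₂ δ
  tree⇒map (T , fixed , rep) =
    let r , a , r≢a , lca = FixedCherryTree⇒LcaLabel fixed
    in from FixedCherryMap⇔InducedBy (r , a , r≢a , Represents⇒InducedBy lca rep)

  map⇒tree : FixedCherryMap x₁ x₂ δ → ∃[ T ] (FixedCherryTree n x₁ x₂ T × Represents T δ)
  map⇒tree fcm =
    let r , a , r≢a , induced = to FixedCherryMap⇔InducedBy fcm
        ys , ys-compl = complement x₁≢x₂
        open CherryTree ys-compl r a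
    in cherryTree , cherryTree-fixedCherry 5≤n r≢a , InducedBy⇒Represents cherryTree-LcaLabel induced
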